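{- Let $\mathbf{L}$ be either the standard Łukasiewicz algebra or the standard product algebra. Then for any finite theory $\Sigma$ and any rational evaluation $e$ there is $n<\omega$ such that $e^\omega_\Sigma=e^n_\Sigma$.
   Context: Standard Łukasiewicz algebra: $[0,1]$ with min, max, $a\otimes b=\max\{0,a+b-1\}$, $a\rightarrow b=\min\{1,1-a+b\}$. Standard product algebra: $[0,1]$ with min, max, $a\otimes b=ab$, $a\rightarrow b=1$ if $a\le b$ and $b/a$ otherwise. $\mathbf{L}$-sets in $U$ are maps $U\to[0,1]$; finite = finite support; rational = rational values; union pointwise sup; $(c\otimes A)(u)=c\otimes A(u)$; $S(A,B)=\bigwedge_u(A(u)\rightarrow B(u))$. $\mathrm{Var}$ is a denumerable set of propositional variables; a formula is $A\Rightarrow B$ with $A,B$ finite rational $\mathbf{L}$-sets in $\mathrm{Var}$; a theory is a set of formulas. An evaluation is a map $e:\mathrm{Var}\to[0,1]$; it is rational if all its values are rational. Define $e^0_\Sigma=e$, $e^{n+1}_\Sigma=e^n_\Sigma\cup\bigcup\{S(A,e^n_\Sigma)\otimes B: A\Rightarrow B\in\Sigma\}$, and $e^\omega_\Sigma=\bigcup_{n<\omega}e^n_\Sigma$. -}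

module Defs where

open import Data.Nat using (ℕ; zero; suc)
open import Data.Nat.Properties using () renaming (_≟_ to _≟ℕ_)
open import Data.Rational using (ℚ; 0ℚ; 1ℚ; _+_; _-_; _*_; _÷_; _⊔_; _⊓_; _≤_; ≢-nonZero)
open import Data.Rational.Properties using (_≤?_; _≟_)
open import Data.List using (List; []; _∷_; foldr; map)
open import Data.List.Relation.Unary.All using (All)
open import Data.Product using (_×_; _,_; proj₁; proj₂)
open import Relation.Nullary using (yes; no)

-- The two standard algebras on [0,1] (restricted to rational values,
-- which are closed under all operations of both algebras).
data Algebra : Set where
  Łukasiewicz : Algebra
  Product     : Algebra

_⊗[_]_ : ℚ → Algebra → ℚ → ℚ
a ⊗[ Łukasiewicz ] b = 0ℚ ⊔ ((a + b) - 1ℚ)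
a ⊗[ Product ] b = a * b

_⇒[_]_ : ℚ → Algebra → ℚ → ℚ
a ⇒[ Łukasiewicz ] b = 1ℚ ⊓ ((1ℚ - a) + b)
a ⇒[ Product ] b with a ≤? b
... | yes _ = 1ℚ
... | no _ with a ≟ 0ℚ
...   | yes _ = 1ℚ
...   | no a≢0 = _÷_ b a {{≢-nonZero a≢0}}

InUnit : ℚ → Set
InUnit a = (0ℚ ≤ a) × (a ≤ 1ℚ)

Var : Set
Var = ℕ

LSet : Set
LSet = Var → ℚ

-- A finite rational L-set, presented by a finite list of (variable, degree)
-- pairs; its membership degree at u is the maximum of the degrees listed
-- for u (0 if u is not listed).
FinLSet : Set
FinLSet = List (Var × ℚ)

WellFormedFin : FinLSet → Set
WellFormedFin A = All (λ p → InUnit (proj₂ p)) A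

⟦_⟧ : FinLSet → LSet
⟦ [] ⟧ u = 0ℚ
⟦ (v , a) ∷ A ⟧ u with v ≟ℕ u
... | yes _ = a ⊔ ⟦ A ⟧ u
... | no _  = ⟦ A ⟧ u

_∪_ : LSet → LSet → LSet
(A ∪ B) u = A u ⊔ B u

-- subsethood degree S(A,B) = ⋀_u (A(u) → B(u)) for finite A: for u outside
-- the support A(u) = 0 and 0 → B(u) = 1, so the infimum ranges over the
-- (finite) list of support variables of A.
S[_] : Algebra → FinLSet → LSet → ℚ
S[ L ] A B = foldr (λ p r → (⟦ A ⟧ (proj₁ p) ⇒[ L ] B (proj₁ p)) ⊓ r) 1ℚ A

record Formula : Set where
  constructor _⟹_
  field
    lhs : FinLSet
    rhs : FinLSet
open Formula public

WellFormedFormula : Formula → Set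
WellFormedFormula (A ⟹ B) = WellFormedFin A × WellFormedFin B

Theory : Set
Theory = List Formula

Evaluation : Set
Evaluation = Var → ℚ

step : Algebra → Theory → Evaluation → Evaluation
step L Σ f u = f u ⊔ foldr (λ φ r → (S[ L ] (lhs φ) f ⊗[ L ] ⟦ rhs φ ⟧ u) ⊔ r) 0ℚ Σ

iter : Algebra → Theory → Evaluation → ℕ → Evaluation
iter L Σ e zero = e
iter L Σ e (suc n) = step L Σ (iter L Σ e n)

IsSup : (ℕ → ℚ) → ℚ → Set
IsSup f x = (∀ k → f k ≤ x) × (∀ y → (∀ k → f k ≤ y) → x ≤ y)

-- e^ω_Σ = e^n_Σ : for every variable, e^n_Σ(v) is the supremum ⋁_k e^k_Σ(v)
OmegaEq : Algebra → Theory → Evaluation → ℕ → Set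
OmegaEq L Σ e n = ∀ (v : Var) → IsSup (λ k → iter L Σ e k v) (iter L Σ e n v)

-- If e^{n+1}(u) exceeds e^n(u), the new value is either a right-hand degree of Σ or arises from some
-- e^n(q) by a link y ↦ c + y (Łukasiewicz) or y ↦ c · y (product), with c from a finite set fixed by Σ.
-- Tracing values back along links gives chains. Within any M + 1 consecutive nodes of a chain (M the
-- number of variables of Σ) some variable repeats, and between its two visits it rose by at least a
-- fixed γ > 0; in the product case this uses that positive values are bounded away from 0. As the sum
-- of all values is at most M, chains are bounded, so all values lie in a finite set; the monotone
-- iteration therefore pauses for one step, and from then on it is constant.

module Submission where

open import Defs
open import Data.Empty using (⊥-elim)
open import Data.Fin using (toℕ)
import Data.Fin.Properties as FinP
open import Data.Integer using (+_; +[1+_]; -[1+_])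
import Data.Integer as ℤ
import Data.Integer.Solver as ℤSolver
open import Data.List using (List; []; _∷_; foldr; map; _++_; length; lookup; concatMap; cartesianProduct; cartesianProductWith)
open import Data.List.Membership.Propositional using (_∈_; find)
open import Data.List.Membership.Propositional.Properties using (∈-map⁺; ∈-++⁺ˡ; ∈-++⁺ʳ; ∈-concat⁺′; ∈-cartesianProduct⁺; ∈-cartesianProduct⁻; ∈-cartesianProductWith⁺)
open import Data.List.Relation.Unary.All as All using (All; []; _∷_)
open import Data.List.Relation.Unary.All.Properties using (¬All⇒Any¬)
open import Data.List.Relation.Unary.Any using (here; there; index)
open import Data.List.Relation.Unary.Any.Properties using (lookup-index)
open import Data.Nat as ℕ using (ℕ; zero; suc; z≤n; s≤s; _∸_) renaming (_≤_ to _≤ₙ_; _<_ to _<ₙ_; _+_ to _+ₙ_; _*_ to _*ₙ_)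
import Data.Nat.Properties as ℕP
open import Data.List.Membership.DecPropositional ℕP._≟_ using (_∈?_)
open import Data.Product using (_×_; _,_; proj₁; proj₂; ∃; ∃-syntax)
open import Data.Rational
open import Data.Rational.Properties
import Data.Rational.Unnormalised as ℚᵘ
import Data.Rational.Unnormalised.Properties as ℚᵘP
open import Data.Rational.Solver using (module +-*-Solver)
open import Data.Sum as Sum using (_⊎_; inj₁; inj₂; [_,_]′)
open import Function using (_∘_)
open import Relation.Binary using (tri<; tri≈; tri>)
open import Relation.Binary.PropositionalEquality
open import Relation.Nullary using (¬_; yes; no)
open import Relation.Unary using (Decidable)

≤∧≢⇒< : ∀ {p q} → p ≤ q → p ≢ q → p < q
≤∧≢⇒< {p} {q} p≤q p≢q with <-cmp p q
... | tri< p<q _ _ = p<q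
... | tri≈ _ p≡q _ = ⊥-elim (p≢q p≡q)
... | tri> _ _ q<p = ⊥-elim (<-irrefl refl (<-≤-trans q<p p≤q))

0<1 : 0ℚ < 1ℚ
0<1 = positive⁻¹ 1ℚ

0≤1 : 0ℚ ≤ 1ℚ
0≤1 = <⇒≤ 0<1

0<⇒≢0 : ∀ {p} → 0ℚ < p → p ≢ 0ℚ
0<⇒≢0 0<p p≡0 = <-irrefl (sym p≡0) 0<p

≤⇒0≤- : ∀ {p q} → p ≤ q → 0ℚ ≤ q - p
≤⇒0≤- {p} {q} p≤q = subst (_≤ q - p) (+-inverseʳ p) (+-monoˡ-≤ (- p) p≤q)

<⇒0<- : ∀ {p q} → p < q → 0ℚ < q - p
<⇒0<- {p} {q} p<q = subst (_< q - p) (+-inverseʳ p) (+-monoˡ-< (- p) p<q)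

0≤+ : ∀ {p q} → 0ℚ ≤ p → 0ℚ ≤ q → 0ℚ ≤ p + q
0≤+ {p} {q} 0≤p 0≤q = nonNegative⁻¹ (p + q) {{nonNeg+nonNeg⇒nonNeg p {{nonNegative 0≤p}} q {{nonNegative 0≤q}}}}

0≤* : ∀ {p q} → 0ℚ ≤ p → 0ℚ ≤ q → 0ℚ ≤ p * q
0≤* {p} {q} 0≤p 0≤q = nonNegative⁻¹ (p * q) {{nonNeg*nonNeg⇒nonNeg p {{nonNegative 0≤p}} q {{nonNegative 0≤q}}}}

0<* : ∀ {p q} → 0ℚ < p → 0ℚ < q → 0ℚ < p * q
0<* {p} {q} 0<p 0<q = positive⁻¹ (p * q) {{pos*pos⇒pos p {{positive 0<p}} q {{positive 0<q}}}}

*-mono-≤-nonNeg : ∀ {p q r s} → 0ℚ ≤ q → 0ℚ ≤ r → p ≤ q → r ≤ s → p * r ≤ q * s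
*-mono-≤-nonNeg {p} {q} {r} {s} 0≤q 0≤r p≤q r≤s =
  ≤-trans (*-monoʳ-≤-nonNeg r {{nonNegative 0≤r}} p≤q) (*-monoˡ-≤-nonNeg q {{nonNegative 0≤q}} r≤s)

module _ {A : Set} where

  ⋁ : (A → ℚ) → ℚ → List A → ℚ
  ⋁ h z xs = foldr (λ x r → h x ⊔ r) z xs

  ⋀ : (A → ℚ) → ℚ → List A → ℚ
  ⋀ h z xs = foldr (λ x r → h x ⊓ r) z xs

  ⋁-sel : ∀ h z xs → ⋁ h z xs ≡ z ⊎ ∃[ x ] x ∈ xs × ⋁ h z xs ≡ h x
  ⋁-sel h z [] = inj₁ refl
  ⋁-sel h z (x ∷ xs) with ⊔-sel (h x) (⋁ h z xs)
  ... | inj₁ eq = inj₂ (x , here refl , eq)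
  ... | inj₂ eq with ⋁-sel h z xs
  ...   | inj₁ eq′ = inj₁ (trans eq eq′)
  ...   | inj₂ (y , y∈ , eq′) = inj₂ (y , there y∈ , trans eq eq′)

  ⋀-sel : ∀ h z xs → ⋀ h z xs ≡ z ⊎ ∃[ x ] x ∈ xs × ⋀ h z xs ≡ h x
  ⋀-sel h z [] = inj₁ refl
  ⋀-sel h z (x ∷ xs) with ⊓-sel (h x) (⋀ h z xs)
  ... | inj₁ eq = inj₂ (x , here refl , eq)
  ... | inj₂ eq with ⋀-sel h z xs
  ...   | inj₁ eq′ = inj₁ (trans eq eq′)
  ...   | inj₂ (y , y∈ , eq′) = inj₂ (y , there y∈ , trans eq eq′)

  ⋀≤z : ∀ h z xs → ⋀ h z xs ≤ z
  ⋀≤z h z [] = ≤-refl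
  ⋀≤z h z (x ∷ xs) = p≤q⇒r⊓p≤q (h x) (⋀≤z h z xs)

  ⋁-lub : ∀ h z xs {b} → z ≤ b → (∀ {x} → x ∈ xs → h x ≤ b) → ⋁ h z xs ≤ b
  ⋁-lub h z [] z≤b hx≤b = z≤b
  ⋁-lub h z (x ∷ xs) z≤b hx≤b = ⊔-lub (hx≤b (here refl)) (⋁-lub h z xs z≤b (hx≤b ∘ there))

  ⋀-glb : ∀ h z xs {b} → b ≤ z → (∀ {x} → x ∈ xs → b ≤ h x) → b ≤ ⋀ h z xs
  ⋀-glb h z [] b≤z b≤hx = b≤z
  ⋀-glb h z (x ∷ xs) b≤z b≤hx = ⊓-glb (b≤hx (here refl)) (⋀-glb h z xs b≤z (b≤hx ∘ there))

count : {A : Set} {P : A → Set} → Decidable P → List A → ℕ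
count P? [] = 0
count P? (x ∷ xs) with P? x
... | yes _ = suc (count P? xs)
... | no _ = count P? xs

count≤length : {A : Set} {P : A → Set} (P? : Decidable P) (xs : List A) → count P? xs ≤ₙ length xs
count≤length P? [] = z≤n
count≤length P? (x ∷ xs) with P? x
... | yes _ = s≤s (count≤length P? xs)
... | no _ = ℕP.m≤n⇒m≤1+n (count≤length P? xs)

module _ {A : Set} {P Q : A → Set} (P? : Decidable P) (Q? : Decidable Q) where

  count-mono : ∀ xs → (∀ {x} → x ∈ xs → P x → Q x) → count P? xs ≤ₙ count Q? xs
  count-mono [] P⇒Q = z≤n
  count-mono (x ∷ xs) P⇒Q with P? x | Q? x
  ... | yes _ | yes _ = s≤s (count-mono xs (P⇒Q ∘ there))
  ... | yes p | no ¬q = ⊥-elim (¬q (P⇒Q (here refl) p))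
  ... | no _ | yes _ = ℕP.m≤n⇒m≤1+n (count-mono xs (P⇒Q ∘ there))
  ... | no _ | no _ = count-mono xs (P⇒Q ∘ there)

  count-strict : ∀ xs → (∀ {x} → x ∈ xs → P x → Q x) → ∀ {w} → w ∈ xs → ¬ P w → Q w →
                 count P? xs <ₙ count Q? xs
  count-strict (x ∷ xs) P⇒Q (here refl) ¬p q with P? x | Q? x
  ... | yes p | _ = ⊥-elim (¬p p)
  ... | no _ | yes _ = s≤s (count-mono xs (P⇒Q ∘ there))
  ... | no _ | no ¬q = ⊥-elim (¬q q)
  count-strict (x ∷ xs) P⇒Q (there w∈) ¬p q with P? x | Q? x
  ... | yes _ | yes _ = s≤s (count-strict xs (P⇒Q ∘ there) w∈ ¬p q)
  ... | yes p | no ¬q = ⊥-elim (¬q (P⇒Q (here refl) p))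
  ... | no _ | yes _ = s≤s (count-mono xs (P⇒Q ∘ there))
  ... | no _ | no _ = count-strict xs (P⇒Q ∘ there) w∈ ¬p q

module _ {A : Set} where

  sumOver : (A → ℚ) → List A → ℚ
  sumOver g [] = 0ℚ
  sumOver g (x ∷ xs) = g x + sumOver g xs

  sumOver-mono : ∀ {g h} xs → (∀ {x} → x ∈ xs → g x ≤ h x) → sumOver g xs ≤ sumOver h xs
  sumOver-mono [] g≤h = ≤-refl
  sumOver-mono (x ∷ xs) g≤h = +-mono-≤ (g≤h (here refl)) (sumOver-mono xs (g≤h ∘ there))

  sumOver-gap : ∀ {g h} xs {γ w} → (∀ {x} → x ∈ xs → g x ≤ h x) → w ∈ xs → g w + γ ≤ h w →
                sumOver g xs + γ ≤ sumOver h xs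
  sumOver-gap {g} {h} (x ∷ xs) {γ} g≤h (here refl) gap =
    subst (_≤ sumOver h (x ∷ xs)) (solve 3 (λ a b c → (a :+ c) :+ b := (a :+ b) :+ c) refl (g x) (sumOver g xs) γ)
      (+-mono-≤ gap (sumOver-mono xs (g≤h ∘ there)))
    where open +-*-Solver
  sumOver-gap {g} {h} (x ∷ xs) {γ} g≤h (there w∈) gap =
    subst (_≤ sumOver h (x ∷ xs)) (sym (+-assoc (g x) (sumOver g xs) γ))
      (+-mono-≤ (g≤h (here refl)) (sumOver-gap xs (g≤h ∘ there) w∈ gap))

  0≤sumOver : ∀ {g} xs → (∀ {x} → x ∈ xs → 0ℚ ≤ g x) → 0ℚ ≤ sumOver g xs
  0≤sumOver [] 0≤g = ≤-refl
  0≤sumOver (x ∷ xs) 0≤g = 0≤+ (0≤g (here refl)) (0≤sumOver xs (0≤g ∘ there))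

minAbove : ℚ → ℚ → List ℚ → ℚ
minAbove θ d [] = d
minAbove θ d (x ∷ xs) with θ <? x
... | yes _ = x ⊓ minAbove θ d xs
... | no _ = minAbove θ d xs

θ<minAbove : ∀ {θ d} xs → θ < d → θ < minAbove θ d xs
θ<minAbove [] θ<d = θ<d
θ<minAbove {θ} (x ∷ xs) θ<d with θ <? x
... | yes θ<x = [ (λ eq → subst (θ <_) (sym eq) θ<x) , (λ eq → subst (θ <_) (sym eq) (θ<minAbove xs θ<d)) ]′ (⊓-sel x _)
... | no _ = θ<minAbove xs θ<d

minAbove≤ : ∀ {θ d x} xs → x ∈ xs → θ < x → minAbove θ d xs ≤ x
minAbove≤ {θ} (y ∷ xs) (here refl) θ<x with θ <? y
... | yes _ = p⊓q≤p y _
... | no θ≮y = ⊥-elim (θ≮y θ<x)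
minAbove≤ {θ} (y ∷ xs) (there x∈) θ<x with θ <? y
... | yes _ = ≤-trans (p⊓q≤q y _) (minAbove≤ xs x∈ θ<x)
... | no _ = minAbove≤ xs x∈ θ<x

minAbove≤cap : ∀ {θ d} xs → minAbove θ d xs ≤ d
minAbove≤cap [] = ≤-refl
minAbove≤cap {θ} (x ∷ xs) with θ <? x
... | yes _ = ≤-trans (p⊓q≤q x _) (minAbove≤cap xs)
... | no _ = minAbove≤cap xs

_^_ : ℚ → ℕ → ℚ
δ ^ zero = 1ℚ
δ ^ suc n = δ * δ ^ n

module _ {δ} (0<δ : 0ℚ < δ) (δ≤1 : δ ≤ 1ℚ) where

  ^-pos : ∀ n → 0ℚ < δ ^ n
  ^-pos zero = 0<1
  ^-pos (suc n) = 0<* 0<δ (^-pos n)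

  ^-antitone : ∀ {m n} → m ≤ₙ n → δ ^ n ≤ δ ^ m
  ^-antitone {zero} {zero} _ = ≤-refl
  ^-antitone {zero} {suc n} _ =
    ≤-trans (*-monoʳ-≤-nonNeg (δ ^ n) {{nonNegative (<⇒≤ (^-pos n))}} δ≤1)
            (subst (_≤ 1ℚ) (sym (*-identityˡ (δ ^ n))) (^-antitone {zero} {n} z≤n))
  ^-antitone {suc m} {suc n} (s≤s m≤n) = *-monoˡ-≤-nonNeg δ {{nonNegative (<⇒≤ 0<δ)}} (^-antitone m≤n)

_•_ : ℕ → ℚ → ℚ
zero • q = 0ℚ
suc n • q = q + n • q

•-distribʳ-+ : ∀ m n q → (m +ₙ n) • q ≡ m • q + n • q
•-distribʳ-+ zero n q = sym (+-identityˡ (n • q))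
•-distribʳ-+ (suc m) n q = trans (cong (λ r → q + r) (•-distribʳ-+ m n q)) (sym (+-assoc q (m • q) (n • q)))

sumOver≤length• : ∀ {A : Set} {g : A → ℚ} xs → (∀ {x} → x ∈ xs → g x ≤ 1ℚ) → sumOver g xs ≤ length xs • 1ℚ
sumOver≤length• [] g≤1 = ≤-refl
sumOver≤length• (x ∷ xs) g≤1 = +-mono-≤ (g≤1 (here refl)) (sumOver≤length• xs (g≤1 ∘ there))

private
  fromℕ : ℕ → ℚ
  fromℕ n = + n / 1

  fromℕ-suc : ∀ n → fromℕ (suc n) ≡ 1ℚ + fromℕ n
  fromℕ-suc n = toℚᵘ-injective (ℚᵘP.≃-trans (toℚᵘ-fromℚᵘ (ℚᵘ.mkℚᵘ (+ suc n) 0))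
    (ℚᵘP.≃-trans unnormalised (ℚᵘP.≃-sym (ℚᵘP.≃-trans (toℚᵘ-homo-+ 1ℚ (fromℕ n))
      (ℚᵘP.+-cong (ℚᵘP.≃-refl {toℚᵘ 1ℚ}) (toℚᵘ-fromℚᵘ (ℚᵘ.mkℚᵘ (+ n) 0)))))))
    where
    open ℤSolver.+-*-Solver
    unnormalised : ℚᵘ.mkℚᵘ (+ suc n) 0 ℚᵘ.≃ (toℚᵘ 1ℚ ℚᵘ.+ ℚᵘ.mkℚᵘ (+ n) 0)
    unnormalised = ℚᵘ.*≡* (solve 1 (λ x → (con (+ 1) :+ x) :* (con (+ 1) :* con (+ 1))
                                   := (con (+ 1) :* con (+ 1) :+ x :* con (+ 1)) :* con (+ 1)) refl (+ n))

  •≡fromℕ* : ∀ n q → n • q ≡ fromℕ n * q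
  •≡fromℕ* zero q = sym (*-zeroˡ q)
  •≡fromℕ* (suc n) q = begin
    q + n • q                  ≡⟨ cong₂ _+_ (sym (*-identityˡ q)) (•≡fromℕ* n q) ⟩
    1ℚ * q + fromℕ n * q       ≡⟨ sym (*-distribʳ-+ q 1ℚ (fromℕ n)) ⟩
    (1ℚ + fromℕ n) * q         ≡⟨ cong (_* q) (sym (fromℕ-suc n)) ⟩
    fromℕ (suc n) * q          ∎
    where open ≡-Reasoning

  -- For γ = (a+1)/(b+1) in lowest terms, 1/γ ≤ b+1.
  1≤•pos : ∀ {γ} → 0ℚ < γ → ∃[ k ] 1ℚ ≤ k • γ
  1≤•pos {γ@(mkℚ +[1+ a ] b _)} 0<γ =
    suc b , subst (_≤ suc b • γ) (*-inverseˡ γ) (subst ((1/ γ) * γ ≤_) (sym (•≡fromℕ* (suc b) γ))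
      (*-monoʳ-≤-nonNeg γ {{nonNegative (<⇒≤ 0<γ)}} 1/γ≤b+1))
    where
    1/γ≤b+1 : 1/ γ ≤ fromℕ (suc b)
    1/γ≤b+1 = toℚᵘ-cancel-≤ (ℚᵘP.≤-respʳ-≃ (ℚᵘP.≃-sym (toℚᵘ-fromℚᵘ (ℚᵘ.mkℚᵘ (+ suc b) 0)))
                (ℚᵘ.*≤* (ℤ.+≤+ (ℕP.*-monoʳ-≤ (suc b) (s≤s z≤n)))))
  1≤•pos {mkℚ (+ zero) _ _} (*<* (ℤ.+<+ ()))
  1≤•pos {mkℚ -[1+ _ ] _ _} (*<* ())

archimedean : ∀ {γ} → 0ℚ < γ → ∀ m → ∃[ n ] m • 1ℚ < n • γ
archimedean {γ} 0<γ m with 1≤•pos 0<γ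
... | k , 1≤kγ = suc m *ₙ k , <-≤-trans (m<suc-m m) (copies (suc m))
  where
  copies : ∀ j → j • 1ℚ ≤ (j *ₙ k) • γ
  copies zero = ≤-refl
  copies (suc j) = subst (1ℚ + j • 1ℚ ≤_) (sym (•-distribʳ-+ k (j *ₙ k) γ)) (+-mono-≤ 1≤kγ (copies j))
  m<suc-m : ∀ m → m • 1ℚ < suc m • 1ℚ
  m<suc-m m = subst (_< 1ℚ + m • 1ℚ) (+-identityˡ (m • 1ℚ)) (+-monoˡ-< (m • 1ℚ) 0<1)

⊗-InUnit : ∀ L {s b} → InUnit s → InUnit b → InUnit (s ⊗[ L ] b)
⊗-InUnit Łukasiewicz {s} {b} (_ , s≤1) (_ , b≤1) = p≤p⊔q 0ℚ ((s + b) - 1ℚ) , ⊔-lub 0≤1 s+b-1≤1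
  where
  open +-*-Solver
  s+b-1≤1 : (s + b) - 1ℚ ≤ 1ℚ
  s+b-1≤1 = subst ((s + b) - 1ℚ ≤_) (solve 0 (con 1ℚ :+ con 1ℚ :- con 1ℚ := con 1ℚ) refl)
              (+-monoˡ-≤ (- 1ℚ) (+-mono-≤ s≤1 b≤1))
⊗-InUnit Product {s} {b} (0≤s , s≤1) (0≤b , b≤1) =
  0≤* 0≤s 0≤b , ≤-trans (*-monoʳ-≤-nonNeg b {{nonNegative 0≤b}} s≤1) (subst (_≤ 1ℚ) (sym (*-identityˡ b)) b≤1)

⊗-zeroʳ : ∀ L {s} → s ≤ 1ℚ → s ⊗[ L ] 0ℚ ≡ 0ℚ
⊗-zeroʳ Łukasiewicz {s} s≤1 = p≥q⇒p⊔q≡p (subst (λ r → r - 1ℚ ≤ 0ℚ) (sym (+-identityʳ s))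
                                   (subst (s - 1ℚ ≤_) (+-inverseʳ 1ℚ) (+-monoˡ-≤ (- 1ℚ) s≤1)))
⊗-zeroʳ Product {s} _ = *-zeroʳ s

⊗-identityˡ : ∀ L {b} → 0ℚ ≤ b → 1ℚ ⊗[ L ] b ≡ b
⊗-identityˡ Łukasiewicz {b} 0≤b =
  trans (cong (0ℚ ⊔_) (solve 1 (λ b → (con 1ℚ :+ b) :- con 1ℚ := b) refl b)) (p≤q⇒p⊔q≡q 0≤b)
  where open +-*-Solver
⊗-identityˡ Product {b} _ = *-identityˡ b

⇒-nonNeg : ∀ L {a x} → a ≤ 1ℚ → 0ℚ ≤ x → 0ℚ ≤ a ⇒[ L ] x
⇒-nonNeg Łukasiewicz a≤1 0≤x = ⊓-glb 0≤1 (0≤+ (≤⇒0≤- a≤1) 0≤x)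
⇒-nonNeg Product {a} {x} _ 0≤x with a ≤? x
... | yes _ = 0≤1
... | no a≰x with a ≟ 0ℚ
...   | yes _ = 0≤1
...   | no _ = 0≤* 0≤x (<⇒≤ (positive⁻¹ _ {{1/pos⇒pos a {{positive (≤-<-trans 0≤x (≰⇒> a≰x))}}}}))

_⊙[_]_ : ℚ → Algebra → ℚ → ℚ
c ⊙[ Łukasiewicz ] y = c + y
c ⊙[ Product ] y = c * y

ε[_] : Algebra → ℚ
ε[ Łukasiewicz ] = 0ℚ
ε[ Product ] = 1ℚ

⊙-identityˡ : ∀ L y → ε[ L ] ⊙[ L ] y ≡ y
⊙-identityˡ Łukasiewicz y = +-identityˡ y
⊙-identityˡ Product y = *-identityˡ y

⊙-assoc : ∀ L a b y → (a ⊙[ L ] b) ⊙[ L ] y ≡ a ⊙[ L ] (b ⊙[ L ] y)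
⊙-assoc Łukasiewicz a b y = +-assoc a b y
⊙-assoc Product a b y = *-assoc a b y

link : Algebra → ℚ → ℚ → ℚ
link Łukasiewicz a b = b - a
link Product a b with a ≟ 0ℚ
... | yes _ = 0ℚ
... | no a≢0 = _÷_ b a {{≢-nonZero a≢0}}

residuum-cap-or-link : ∀ L {a x b} → 0ℚ ≤ x → 0ℚ < (a ⇒[ L ] x) ⊗[ L ] b →
                       (a ⇒[ L ] x ≡ 1ℚ) ⊎ (a ≢ 0ℚ × (a ⇒[ L ] x) ⊗[ L ] b ≡ link L a b ⊙[ L ] x)
residuum-cap-or-link Product {a} {x} {b} _ _ with a ≤? x
... | yes _ = inj₁ refl
... | no _ with a ≟ 0ℚ
...   | yes _ = inj₁ refl
...   | no a≢0 = inj₂ (a≢0 , solve 3 (λ x a⁻¹ b → (x :* a⁻¹) :* b := (b :* a⁻¹) :* x) refl x ((1/ a) {{≢-nonZero a≢0}}) b)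
  where open +-*-Solver
residuum-cap-or-link Łukasiewicz {a} {x} {b} 0≤x 0<y with 1ℚ ≤? (1ℚ - a) + x
... | yes 1≤w = inj₁ (p≤q⇒p⊓q≡p 1≤w)
... | no 1≰w = inj₂ (a≢0 , shifted)
  where
  open +-*-Solver
  w = (1ℚ - a) + x
  residuum≡w : a ⇒[ Łukasiewicz ] x ≡ w
  residuum≡w = p≥q⇒p⊓q≡q (<⇒≤ (≰⇒> 1≰w))
  a≢0 : a ≢ 0ℚ
  a≢0 refl = 1≰w (subst (_≤ w) (+-identityʳ 1ℚ) (+-monoʳ-≤ (1ℚ - 0ℚ) 0≤x))
  shifted : (a ⇒[ Łukasiewicz ] x) ⊗[ Łukasiewicz ] b ≡ (b - a) + x
  shifted with ⊔-sel 0ℚ ((w + b) - 1ℚ)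
  ... | inj₁ y≡0 = ⊥-elim (0<⇒≢0 0<y (trans (cong (λ r → r ⊗[ Łukasiewicz ] b) residuum≡w) y≡0))
  ... | inj₂ y≡ = trans (cong (λ r → r ⊗[ Łukasiewicz ] b) residuum≡w)
                   (trans y≡ (solve 3 (λ a x b → (((con 1ℚ :- a) :+ x) :+ b) :- con 1ℚ := (b :- a) :+ x) refl a x b))

vars : Theory → List Var
vars = concatMap (λ φ → map proj₁ (lhs φ) ++ map proj₁ (rhs φ))

lhsDegrees : Theory → List ℚ
lhsDegrees = concatMap (map proj₂ ∘ lhs)

rhsDegrees : Theory → List ℚ
rhsDegrees = concatMap (map proj₂ ∘ rhs)

links : Algebra → Theory → List ℚ
links L Σ = cartesianProductWith (link L) (lhsDegrees Σ) (rhsDegrees Σ)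

⟦⟧-sel : ∀ A u → ⟦ A ⟧ u ≡ 0ℚ ⊎ ⟦ A ⟧ u ∈ map proj₂ A
⟦⟧-sel [] u = inj₁ refl
⟦⟧-sel ((v , a) ∷ A) u with v ℕP.≟ u
... | no _ = Sum.map₂ there (⟦⟧-sel A u)
... | yes _ with ⊔-sel a (⟦ A ⟧ u)
...   | inj₁ eq = inj₂ (subst (_∈ map proj₂ ((v , a) ∷ A)) (sym eq) (here refl))
...   | inj₂ eq = Sum.map (trans eq) (subst (_∈ map proj₂ ((v , a) ∷ A)) (sym eq) ∘ there) (⟦⟧-sel A u)

⟦⟧-outside : ∀ A {u} → ¬ u ∈ map proj₁ A → ⟦ A ⟧ u ≡ 0ℚ
⟦⟧-outside [] _ = refl
⟦⟧-outside ((v , a) ∷ A) {u} u∉ with v ℕP.≟ u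
... | yes refl = ⊥-elim (u∉ (here refl))
... | no _ = ⟦⟧-outside A (u∉ ∘ there)

⟦⟧-InUnit : ∀ {A} → WellFormedFin A → ∀ u → InUnit (⟦ A ⟧ u)
⟦⟧-InUnit [] u = ≤-refl , 0≤1
⟦⟧-InUnit {(v , a) ∷ A} ((0≤a , a≤1) ∷ wf) u with v ℕP.≟ u
... | no _ = ⟦⟧-InUnit wf u
... | yes _ = ≤-trans 0≤a (p≤p⊔q a (⟦ A ⟧ u)) , ⊔-lub a≤1 (proj₂ (⟦⟧-InUnit wf u))

module _ {Σ : Theory} {φ : Formula} (φ∈Σ : φ ∈ Σ) where

  lhs-var∈vars : ∀ {p} → p ∈ map proj₁ (lhs φ) → p ∈ vars Σ
  lhs-var∈vars p∈ = ∈-concat⁺′ (∈-++⁺ˡ p∈) (∈-map⁺ _ φ∈Σ)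

  rhs-outside : ∀ {u} → ¬ u ∈ vars Σ → ⟦ rhs φ ⟧ u ≡ 0ℚ
  rhs-outside u∉ = ⟦⟧-outside (rhs φ) (λ u∈ → u∉ (∈-concat⁺′ (∈-++⁺ʳ (map proj₁ (lhs φ)) u∈) (∈-map⁺ _ φ∈Σ)))

  lhs-degree : ∀ p → ⟦ lhs φ ⟧ p ≢ 0ℚ → ⟦ lhs φ ⟧ p ∈ lhsDegrees Σ
  lhs-degree p a≢0 with ⟦⟧-sel (lhs φ) p
  ... | inj₁ a≡0 = ⊥-elim (a≢0 a≡0)
  ... | inj₂ a∈ = ∈-concat⁺′ a∈ (∈-map⁺ _ φ∈Σ)

  rhs-degree : ∀ u → ⟦ rhs φ ⟧ u ≢ 0ℚ → ⟦ rhs φ ⟧ u ∈ rhsDegrees Σ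
  rhs-degree u b≢0 with ⟦⟧-sel (rhs φ) u
  ... | inj₁ b≡0 = ⊥-elim (b≢0 b≡0)
  ... | inj₂ b∈ = ∈-concat⁺′ b∈ (∈-map⁺ _ φ∈Σ)

module _ (L : Algebra) (Σ : Theory) where

  ruleValue : Evaluation → Var → Formula → ℚ
  ruleValue g u φ = S[ L ] (lhs φ) g ⊗[ L ] ⟦ rhs φ ⟧ u

  S-term : FinLSet → Evaluation → Var × ℚ → ℚ
  S-term A g p = ⟦ A ⟧ (proj₁ p) ⇒[ L ] g (proj₁ p)

  S≤1 : ∀ A g → S[ L ] A g ≤ 1ℚ
  S≤1 A g = ⋀≤z (S-term A g) 1ℚ A

  S-InUnit : ∀ {A} g → WellFormedFin A → (∀ v → 0ℚ ≤ g v) → InUnit (S[ L ] A g)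
  S-InUnit {A} g wf 0≤g =
    ⋀-glb (S-term A g) 1ℚ A 0≤1 (λ {(p , _)} _ → ⇒-nonNeg L (proj₂ (⟦⟧-InUnit wf p)) (0≤g p)) , S≤1 A g

  step-InUnit : ∀ {g} → All WellFormedFormula Σ → (∀ v → InUnit (g v)) → ∀ u → InUnit (step L Σ g u)
  step-InUnit {g} wf g∈I u =
    ≤-trans (proj₁ (g∈I u)) (p≤p⊔q _ _) ,
    ⊔-lub (proj₂ (g∈I u)) (⋁-lub (ruleValue g u) 0ℚ Σ 0≤1 (λ φ∈ → proj₂ (rule∈I (All.lookup wf φ∈))))
    where
    rule∈I : ∀ {φ} → WellFormedFormula φ → InUnit (ruleValue g u φ)
    rule∈I (wfA , wfB) = ⊗-InUnit L (S-InUnit g wfA (proj₁ ∘ g∈I)) (⟦⟧-InUnit wfB u)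

  S-cong : ∀ A {g h} → (∀ v → g v ≡ h v) → S[ L ] A g ≡ S[ L ] A h
  S-cong A {g} {h} g≡h = go A
    where
    go : ∀ B → ⋀ (S-term A g) 1ℚ B ≡ ⋀ (S-term A h) 1ℚ B
    go [] = refl
    go ((p , _) ∷ B) = cong₂ _⊓_ (cong (⟦ A ⟧ p ⇒[ L ]_) (g≡h p)) (go B)

  step-cong : ∀ {g h} → (∀ v → g v ≡ h v) → ∀ u → step L Σ g u ≡ step L Σ h u
  step-cong {g} {h} g≡h u = cong₂ _⊔_ (g≡h u) (go Σ)
    where
    go : ∀ Δ → ⋁ (ruleValue g u) 0ℚ Δ ≡ ⋁ (ruleValue h u) 0ℚ Δ
    go [] = refl
    go (φ ∷ Δ) = cong₂ _⊔_ (cong (_⊗[ L ] ⟦ rhs φ ⟧ u) (S-cong (lhs φ) g≡h)) (go Δ)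

  step-outside : ∀ {g u} → 0ℚ ≤ g u → ¬ u ∈ vars Σ → step L Σ g u ≡ g u
  step-outside {g} {u} 0≤gu u∉ = p≥q⇒p⊔q≡p (⋁-lub (ruleValue g u) 0ℚ Σ 0≤gu rule≤gu)
    where
    rule≤gu : ∀ {φ} → φ ∈ Σ → ruleValue g u φ ≤ g u
    rule≤gu {φ} φ∈ = ≤-trans (≤-reflexive (trans (cong (S[ L ] (lhs φ) g ⊗[ L ]_) (rhs-outside φ∈ u∉))
                                                 (⊗-zeroʳ L (S≤1 (lhs φ) g)))) 0≤gu

  iter-InUnit : All WellFormedFormula Σ → ∀ {e} → (∀ v → InUnit (e v)) → ∀ n v → InUnit (iter L Σ e n v)
  iter-InUnit wf e∈I zero = e∈I
  iter-InUnit wf e∈I (suc n) = step-InUnit wf (iter-InUnit wf e∈I n)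

  iter-≤-suc : ∀ e n v → iter L Σ e n v ≤ iter L Σ e (suc n) v
  iter-≤-suc e n v = p≤p⊔q _ _

  iter-mono : ∀ e v {m n} → m ≤ₙ n → iter L Σ e m v ≤ iter L Σ e n v
  iter-mono e v m≤n with ℕP.≤⇒≤′ m≤n
  ... | ℕ.≤′-refl = ≤-refl
  ... | ℕ.≤′-step {n} m≤′n = ≤-trans (iter-mono e v (ℕP.≤′⇒≤ m≤′n)) (iter-≤-suc e n v)

  data Source (g : Evaluation) (y : ℚ) : Set where
    given  : y ∈ rhsDegrees Σ → Source g y
    linked : ∀ {q c} → q ∈ vars Σ → c ∈ links L Σ → y ≡ c ⊙[ L ] g q → Source g y

  module _ (wf : All WellFormedFormula Σ) {g : Evaluation} (g∈I : ∀ v → InUnit (g v)) {u : Var} where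

    module RuleSource {φ} (φ∈ : φ ∈ Σ) (0<y : 0ℚ < ruleValue g u φ) where
      b : ℚ
      b = ⟦ rhs φ ⟧ u

      b≢0 : b ≢ 0ℚ
      b≢0 b≡0 = 0<⇒≢0 0<y (trans (cong (S[ L ] (lhs φ) g ⊗[ L ]_) b≡0) (⊗-zeroʳ L (S≤1 (lhs φ) g)))

      capped : S[ L ] (lhs φ) g ≡ 1ℚ → Source g (ruleValue g u φ)
      capped S≡1 = given (subst (_∈ rhsDegrees Σ) (sym y≡b) (rhs-degree φ∈ u b≢0))
        where
        y≡b : ruleValue g u φ ≡ b
        y≡b = trans (cong (_⊗[ L ] b) S≡1) (⊗-identityˡ L (proj₁ (⟦⟧-InUnit (proj₂ (All.lookup wf φ∈)) u)))

      rule-source : Source g (ruleValue g u φ)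
      rule-source with ⋀-sel (S-term (lhs φ) g) 1ℚ (lhs φ)
      ... | inj₁ S≡1 = capped S≡1
      ... | inj₂ ((p , _) , p∈ , S≡) with residuum-cap-or-link L (proj₁ (g∈I p)) (subst (λ s → 0ℚ < s ⊗[ L ] b) S≡ 0<y)
      ...   | inj₁ ⇒≡1 = capped (trans S≡ ⇒≡1)
      ...   | inj₂ (a≢0 , y≡) =
        linked (lhs-var∈vars φ∈ (∈-map⁺ proj₁ p∈))
               (∈-cartesianProductWith⁺ (link L) (lhs-degree φ∈ p a≢0) (rhs-degree φ∈ u b≢0))
               (trans (cong (_⊗[ L ] b) S≡) y≡)

    open RuleSource using (rule-source)

    rules-source : 0ℚ < ⋁ (ruleValue g u) 0ℚ Σ → Source g (⋁ (ruleValue g u) 0ℚ Σ)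
    rules-source 0<T with ⋁-sel (ruleValue g u) 0ℚ Σ
    ... | inj₁ T≡0 = ⊥-elim (0<⇒≢0 0<T T≡0)
    ... | inj₂ (φ , φ∈ , T≡) = subst (Source g) (sym T≡) (rule-source φ∈ (subst (0ℚ <_) T≡ 0<T))

    increase-source : g u < step L Σ g u → Source g (step L Σ g u)
    increase-source gu<step with ⊔-sel (g u) (⋁ (ruleValue g u) 0ℚ Σ)
    ... | inj₁ step≡gu = ⊥-elim (<-irrefl (sym step≡gu) gu<step)
    ... | inj₂ step≡T = subst (Source g) (sym step≡T) (rules-source (≤-<-trans (proj₁ (g∈I u)) (subst (g u <_) step≡T gu<step)))

module _ (f : ℕ → Var → ℚ) (V : List Var) (X : List ℚ)
         (f-mono : ∀ t {w} → w ∈ V → f t w ≤ f (suc t) w)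
         (f∈X : ∀ t {w} → w ∈ V → f t w ∈ X) where

  Pause : ℕ → Set
  Pause t = All (λ w → f (suc t) w ≡ f t w) V

  private
    below : ℕ → ℕ
    below t = count (λ wx → proj₂ wx ≤? f t (proj₁ wx)) (cartesianProduct V X)

    below-step : ∀ t {w} → w ∈ V → f (suc t) w ≢ f t w → below t <ₙ below (suc t)
    below-step t {w} w∈ moved =
      count-strict _ _ (cartesianProduct V X) (λ {(v , x)} vx∈ x≤ → ≤-trans x≤ (f-mono t (proj₁ (∈-cartesianProduct⁻ V X vx∈))))
        (∈-cartesianProduct⁺ w∈ (f∈X (suc t) w∈)) (λ fw′≤fw → moved (≤-antisym fw′≤fw (f-mono t w∈))) ≤-refl

    search : ∀ n → ∃ Pause ⊎ n ≤ₙ below n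
    search zero = inj₂ z≤n
    search (suc n) with search n
    ... | inj₁ pause = inj₁ pause
    ... | inj₂ n≤below with All.all? (λ w → f (suc n) w ≟ f n w) V
    ...   | yes pause = inj₁ (n , pause)
    ...   | no ¬pause with find (¬All⇒Any¬ (λ w → f (suc n) w ≟ f n w) V ¬pause)
    ...     | w , w∈ , moved = inj₂ (ℕP.≤-trans (s≤s n≤below) (below-step n w∈ moved))

  monotone-finite-pause : ∃ Pause
  monotone-finite-pause with search (suc (length (cartesianProduct V X)))
  ... | inj₁ pause = pause
  ... | inj₂ too-many = ⊥-elim (ℕP.<-irrefl refl (ℕP.≤-trans too-many (count≤length _ (cartesianProduct V X))))

module Saturation (L : Algebra) (Σ : Theory) (wf : All WellFormedFormula Σ)
                  (e : Evaluation) (e∈I : ∀ v → InUnit (e v)) where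

  f : ℕ → Evaluation
  f = iter L Σ e

  f∈I : ∀ n v → InUnit (f n v)
  f∈I = iter-InUnit L Σ wf e∈I

  V : List Var
  V = vars Σ

  M : ℕ
  M = length V

  bases : List ℚ
  bases = rhsDegrees Σ ++ map e V

  linkClosure : List ℚ → ℕ → List ℚ
  linkClosure xs zero = xs
  linkClosure xs (suc k) = linkClosure xs k ++ cartesianProductWith _⊙[ L ]_ (links L Σ) (linkClosure xs k)

  linkClosure-mono : ∀ {xs x m n} → m ≤ₙ n → x ∈ linkClosure xs m → x ∈ linkClosure xs n
  linkClosure-mono m≤n x∈ with ℕP.≤⇒≤′ m≤n
  ... | ℕ.≤′-refl = x∈
  ... | ℕ.≤′-step m≤′n = ∈-++⁺ˡ (linkClosure-mono (ℕP.≤′⇒≤ m≤′n) x∈)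

  linkClosure-link : ∀ {xs k c y} → c ∈ links L Σ → y ∈ linkClosure xs k → c ⊙[ L ] y ∈ linkClosure xs (suc k)
  linkClosure-link {xs} {k} c∈ y∈ = ∈-++⁺ʳ (linkClosure xs k) (∈-cartesianProductWith⁺ _⊙[ L ]_ c∈ y∈)

  composites : ℕ → List ℚ
  composites = linkClosure (ε[ L ] ∷ [])

  Rises : ℕ → Var → Set
  Rises τ u = ∀ {t} → t <ₙ τ → f t u < f τ u

  -- A chain of length ℓ traces the value of u at time τ back through ℓ links to a base value.
  data Chain : ℕ → Var → ℕ → Set where
    origin : ∀ {τ u} → u ∈ V → f τ u ∈ bases → Chain τ u 0
    extend : ∀ {τ u σ q ℓ c} → u ∈ V → Rises τ u → σ <ₙ τ → c ∈ links L Σ →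
             f τ u ≡ c ⊙[ L ] f σ q → Chain σ q ℓ → Chain τ u (suc ℓ)

  chain-to : ∀ σ {p} → p ∈ V → ∃[ σ′ ] ∃[ ℓ ] σ′ ≤ₙ σ × f σ′ p ≡ f σ p × Chain σ′ p ℓ
  chain-to zero p∈ = 0 , 0 , z≤n , refl , origin p∈ (∈-++⁺ʳ (rhsDegrees Σ) (∈-map⁺ e p∈))
  chain-to (suc σ) {p} p∈ with f (suc σ) p ≟ f σ p
  ... | yes same = let σ′ , ℓ , σ′≤σ , eq , ch = chain-to σ p∈ in
                   σ′ , ℓ , ℕP.m≤n⇒m≤1+n σ′≤σ , trans eq (sym same) , ch
  ... | no moved with increase-source L Σ wf (f∈I σ) (≤∧≢⇒< (iter-≤-suc L Σ e σ p) (moved ∘ sym))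
  ...   | given r∈ = suc σ , 0 , ℕP.≤-refl , refl , origin p∈ (∈-++⁺ˡ r∈)
  ...   | linked {c = c} q∈ c∈ eq =
          let σ′ , ℓ , σ′≤σ , eq′ , ch = chain-to σ q∈ in
          suc σ , suc ℓ , ℕP.≤-refl , refl ,
          extend p∈ rises (s≤s σ′≤σ) c∈ (trans eq (cong (c ⊙[ L ]_) (sym eq′))) ch
    where
    rises : Rises (suc σ) p
    rises (s≤s t≤σ) = ≤-<-trans (iter-mono L Σ e p t≤σ) (≤∧≢⇒< (iter-≤-suc L Σ e σ p) (moved ∘ sym))

  chain-value : ∀ {τ u ℓ} → Chain τ u ℓ → f τ u ∈ linkClosure bases ℓ
  chain-value (origin _ b∈) = b∈
  chain-value (extend {ℓ = ℓ} _ _ _ c∈ eq ch) = subst (_∈ _) (sym eq) (linkClosure-link {k = ℓ} c∈ (chain-value ch))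

  -- Node k of a chain, counted from its head; indices beyond the length return the last node.
  time : ∀ {τ u ℓ} → Chain τ u ℓ → ℕ → ℕ
  time {τ} _ zero = τ
  time {τ} (origin _ _) (suc k) = τ
  time (extend _ _ _ _ _ ch) (suc k) = time ch k

  var : ∀ {τ u ℓ} → Chain τ u ℓ → ℕ → Var
  var {u = u} _ zero = u
  var {u = u} (origin _ _) (suc k) = u
  var (extend _ _ _ _ _ ch) (suc k) = var ch k

  value : ∀ {τ u ℓ} → Chain τ u ℓ → ℕ → ℚ
  value ch k = f (time ch k) (var ch k)

  var∈V : ∀ {τ u ℓ} (ch : Chain τ u ℓ) k → var ch k ∈ V
  var∈V (origin u∈ _) zero = u∈
  var∈V (origin u∈ _) (suc k) = u∈
  var∈V (extend u∈ _ _ _ _ _) zero = u∈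
  var∈V (extend _ _ _ _ _ ch) (suc k) = var∈V ch k

  time-antitone : ∀ {τ u ℓ} (ch : Chain τ u ℓ) {i j} → i ≤ₙ j → j ≤ₙ ℓ → time ch j ≤ₙ time ch i
  time-antitone ch {zero} {zero} _ _ = ℕP.≤-refl
  time-antitone (extend _ _ σ<τ _ _ ch) {zero} {suc j} _ (s≤s j≤ℓ) =
    ℕP.≤-trans (time-antitone ch z≤n j≤ℓ) (ℕP.<⇒≤ σ<τ)
  time-antitone (extend _ _ _ _ _ ch) {suc i} {suc j} (s≤s i≤j) (s≤s j≤ℓ) = time-antitone ch i≤j j≤ℓ

  time-strict : ∀ {τ u ℓ} (ch : Chain τ u ℓ) {i j} → i <ₙ j → j ≤ₙ ℓ → time ch j <ₙ time ch i
  time-strict (extend _ _ σ<τ _ _ ch) {zero} {suc j} _ (s≤s j≤ℓ) = ℕP.≤-<-trans (time-antitone ch z≤n j≤ℓ) σ<τ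
  time-strict (extend _ _ _ _ _ ch) {suc i} {suc j} (s≤s i<j) (s≤s j≤ℓ) = time-strict ch i<j j≤ℓ

  rises-at : ∀ {τ u ℓ} (ch : Chain τ u ℓ) {i} → i <ₙ ℓ → Rises (time ch i) (var ch i)
  rises-at (extend _ rises _ _ _ _) {zero} _ = rises
  rises-at (extend _ _ _ _ _ ch) {suc i} (s≤s i<ℓ) = rises-at ch i<ℓ

  composite : ∀ {τ u ℓ} (ch : Chain τ u ℓ) {i j} → i ≤ₙ j → j ≤ₙ ℓ →
              ∃[ π ] π ∈ composites j × value ch i ≡ π ⊙[ L ] value ch j
  composite ch {zero} {zero} _ _ = ε[ L ] , here refl , sym (⊙-identityˡ L _)
  composite (extend {c = c} _ _ _ c∈ eq ch) {zero} {suc j} _ (s≤s j≤ℓ) =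
    let π , π∈ , eq′ = composite ch z≤n j≤ℓ in
    c ⊙[ L ] π , linkClosure-link {k = j} c∈ π∈ , trans eq (trans (cong (c ⊙[ L ]_) eq′) (sym (⊙-assoc L c π _)))
  composite (extend _ _ _ _ _ ch) {suc i} {suc j} (s≤s i≤j) (s≤s j≤ℓ) =
    let π , π∈ , eq = composite ch i≤j j≤ℓ in π , linkClosure-mono (ℕP.n≤1+n j) π∈ , eq

  drop : ∀ {τ u} k {ℓ} (ch : Chain τ u (k +ₙ ℓ)) → Chain (time ch k) (var ch k) ℓ
  drop zero ch = ch
  drop (suc k) (extend _ _ _ _ _ ch) = drop k ch

  Φ : ℕ → ℚ
  Φ τ = sumOver (f τ) V

  0≤Φ : ∀ τ → 0ℚ ≤ Φ τ
  0≤Φ τ = 0≤sumOver V (λ {v} _ → proj₁ (f∈I τ v))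

  Φ≤M : ∀ τ → Φ τ ≤ M • 1ℚ
  Φ≤M τ = sumOver≤length• V (λ {v} _ → proj₂ (f∈I τ v))

  Gap : ℚ → Set
  Gap γ = ∀ τ {w} → w ∈ V → ∀ {π} → π ∈ composites M → f τ w < π ⊙[ L ] f τ w → f τ w + γ ≤ π ⊙[ L ] f τ w

  module _ {γ} (0<γ : 0ℚ < γ) (gap : Gap γ) where

    -- Among the first M + 1 nodes some variable repeats; the chain between the two visits is a
    -- composite link under which that variable strictly rose, so it rose by at least γ.
    window : ∀ {τ u ℓ} (ch : Chain τ u (M +ₙ ℓ)) → Φ (time ch M) + γ ≤ Φ τ
    window {τ} {ℓ = ℓ} ch with FinP.pigeonhole (ℕP.n<1+n M) (λ k → index (var∈V ch (toℕ k)))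
    ... | i , j , i<j , same-index =
      sumOver-gap V (λ {v} _ → iter-mono L Σ e v (time-antitone ch z≤n M≤)) (var∈V ch (toℕ i)) w-gap
      where
      M≤ : M ≤ₙ M +ₙ ℓ
      M≤ = ℕP.m≤m+n M ℓ
      j≤M : toℕ j ≤ₙ M
      j≤M = ℕP.≤-pred (FinP.toℕ<n j)
      j≤ : toℕ j ≤ₙ M +ₙ ℓ
      j≤ = ℕP.≤-trans j≤M M≤
      w = var ch (toℕ i)
      w≡ : w ≡ var ch (toℕ j)
      w≡ = trans (lookup-index (var∈V ch (toℕ i))) (trans (cong (lookup V) same-index) (sym (lookup-index (var∈V ch (toℕ j)))))
      y = f (time ch (toℕ j)) w
      link-between = composite ch (ℕP.<⇒≤ i<j) j≤
      π = proj₁ link-between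
      π∈ : π ∈ composites M
      π∈ = linkClosure-mono j≤M (proj₁ (proj₂ link-between))
      via-π : f (time ch (toℕ i)) w ≡ π ⊙[ L ] y
      via-π = trans (proj₂ (proj₂ link-between)) (cong (λ v → π ⊙[ L ] f (time ch (toℕ j)) v) (sym w≡))
      rose : y < f (time ch (toℕ i)) w
      rose = rises-at ch (ℕP.<-≤-trans i<j j≤) (time-strict ch i<j j≤)
      w-gap : f (time ch M) w + γ ≤ f τ w
      w-gap = begin
        f (time ch M) w + γ        ≤⟨ +-monoˡ-≤ γ (iter-mono L Σ e w (time-antitone ch j≤M M≤)) ⟩
        y + γ                      ≤⟨ gap (time ch (toℕ j)) (var∈V ch (toℕ i)) π∈ (subst (y <_) via-π rose) ⟩
        π ⊙[ L ] y                 ≡⟨ sym via-π ⟩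
        f (time ch (toℕ i)) w      ≤⟨ iter-mono L Σ e w (time-antitone ch z≤n (ℕP.≤-trans (ℕP.<⇒≤ i<j) j≤)) ⟩
        f τ w                      ∎
        where open ≤-Reasoning

    potential-grows : ∀ n {τ u ℓ} → Chain τ u (n *ₙ M +ₙ ℓ) → n • γ ≤ Φ τ
    potential-grows zero {τ} _ = 0≤Φ τ
    potential-grows (suc n) {τ} {u} {ℓ} ch′ = begin
      γ + n • γ               ≡⟨ +-comm γ (n • γ) ⟩
      n • γ + γ               ≤⟨ +-monoˡ-≤ γ (potential-grows n (drop M ch)) ⟩
      Φ (time ch M) + γ       ≤⟨ window ch ⟩
      Φ τ                     ∎
      where
      open ≤-Reasoning
      ch : Chain τ u (M +ₙ (n *ₙ M +ₙ ℓ))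
      ch = subst (Chain τ u) (ℕP.+-assoc M (n *ₙ M) ℓ) ch′

    private
      rounds : ℕ
      rounds = proj₁ (archimedean 0<γ M)

      bound : ℕ
      bound = rounds *ₙ M

    chain-length≤ : ∀ {τ u ℓ} → Chain τ u ℓ → ℓ ≤ₙ bound
    chain-length≤ {τ} {u} {ℓ} ch with bound ℕP.≤? ℓ
    ... | no ℓ<bound = ℕP.<⇒≤ (ℕP.≰⇒> ℓ<bound)
    ... | yes bound≤ℓ = ⊥-elim (<-irrefl refl (begin-strict
      M • 1ℚ        <⟨ proj₂ (archimedean 0<γ M) ⟩
      rounds • γ    ≤⟨ potential-grows rounds (subst (Chain τ u) (sym (ℕP.m+[n∸m]≡n bound≤ℓ)) ch) ⟩
      Φ τ           ≤⟨ Φ≤M τ ⟩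
      M • 1ℚ        ∎))
      where open ≤-Reasoning

    value∈closure : ∀ τ {w} → w ∈ V → f τ w ∈ linkClosure bases bound
    value∈closure τ w∈ with chain-to τ w∈
    ... | _ , _ , _ , same , ch = subst (_∈ _) same (linkClosure-mono (chain-length≤ ch) (chain-value ch))

    saturates : ∃ (OmegaEq L Σ e)
    saturates with monotone-finite-pause f V (linkClosure bases bound) (λ t {w} _ → iter-≤-suc L Σ e t w) value∈closure
    ... | t , pause = t , λ v → upper v , λ _ f≤ → f≤ t
      where
      paused : ∀ u → f (suc t) u ≡ f t u
      paused u with u ∈? V
      ... | yes u∈ = All.lookup pause u∈
      ... | no u∉ = step-outside L Σ {f t} (proj₁ (f∈I t u)) u∉

      stays : ∀ k u → f (k +ₙ t) u ≡ f t u
      stays zero u = refl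
      stays (suc k) u = trans (step-cong L Σ (stays k) u) (paused u)

      upper : ∀ v k → f k v ≤ f t v
      upper v k with k ℕP.≤? t
      ... | yes k≤t = iter-mono L Σ e v k≤t
      ... | no k≰t = ≤-reflexive (subst (λ n → f n v ≡ f t v) (ℕP.m∸n+n≡m (ℕP.<⇒≤ (ℕP.≰⇒> k≰t))) (stays (k ∸ t) v))

Łukasiewicz-saturates : ∀ Σ → All WellFormedFormula Σ → ∀ e → (∀ v → InUnit (e v)) → ∃ (OmegaEq Łukasiewicz Σ e)
Łukasiewicz-saturates Σ wf e e∈I = saturates (θ<minAbove (composites M) 0<1) gap
  where
  open Saturation Łukasiewicz Σ wf e e∈I
  γ : ℚ
  γ = minAbove 0ℚ 1ℚ (composites M)
  gap : Gap γ
  gap τ {w} _ {π} π∈ y<π+y = begin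
    y + γ    ≤⟨ +-monoʳ-≤ y (minAbove≤ (composites M) π∈ 0<π) ⟩
    y + π    ≡⟨ +-comm y π ⟩
    π + y    ∎
    where
    open ≤-Reasoning
    open +-*-Solver
    y = f τ w
    0<π : 0ℚ < π
    0<π = subst (0ℚ <_) (solve 2 (λ p y → (p :+ y) :- y := p) refl π y) (<⇒0<- y<π+y)

module ProductSaturation (Σ : Theory) (wf : All WellFormedFormula Σ) (e : Evaluation) (e∈I : ∀ v → InUnit (e v)) where

  open Saturation Product Σ wf e e∈I

  δ : ℚ
  δ = minAbove 0ℚ 1ℚ (bases ++ links Product Σ)

  0<δ : 0ℚ < δ
  0<δ = θ<minAbove (bases ++ links Product Σ) 0<1

  δ≤1 : δ ≤ 1ℚ
  δ≤1 = minAbove≤cap (bases ++ links Product Σ)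

  δ^suc≤δ : ∀ k → δ ^ suc k ≤ δ
  δ^suc≤δ k = subst (δ ^ suc k ≤_) (*-identityʳ δ) (^-antitone 0<δ δ≤1 {1} {suc k} (s≤s z≤n))

  positives : ℕ → ℕ
  positives τ = count (λ w → 0ℚ <? f τ w) V

  positives-mono : ∀ τ → positives τ ≤ₙ positives (suc τ)
  positives-mono τ = count-mono _ _ V (λ {w} _ 0<fw → <-≤-trans 0<fw (iter-≤-suc Product Σ e τ w))

  -- A value that turns positive is a link constant (≥ δ) times a positive value, and it increases
  -- the number of positive variables.
  positive-lower-bound : ∀ τ {w} → w ∈ V → 0ℚ < f τ w → δ ^ suc (positives τ) ≤ f τ w
  positive-lower-bound zero {w} w∈ 0<ew =
    ≤-trans (δ^suc≤δ (positives 0)) (minAbove≤ (bases ++ links Product Σ) (∈-++⁺ˡ (∈-++⁺ʳ (rhsDegrees Σ) (∈-map⁺ e w∈))) 0<ew)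
  positive-lower-bound (suc τ) {w} w∈ 0<fw with f (suc τ) w ≟ f τ w
  ... | yes same = ≤-trans (^-antitone 0<δ δ≤1 (s≤s (positives-mono τ)))
                     (subst (_ ≤_) (sym same) (positive-lower-bound τ w∈ (subst (0ℚ <_) same 0<fw)))
  ... | no moved with increase-source Product Σ wf (f∈I τ) (≤∧≢⇒< (iter-≤-suc Product Σ e τ w) (moved ∘ sym))
  ...   | given r∈ = ≤-trans (δ^suc≤δ (positives (suc τ))) (minAbove≤ (bases ++ links Product Σ) (∈-++⁺ˡ (∈-++⁺ˡ r∈)) 0<fw)
  ...   | linked {q} {c} q∈ c∈ fw≡cfq with 0ℚ <? f τ w
  ...     | yes 0<fw′ = ≤-trans (^-antitone 0<δ δ≤1 (s≤s (positives-mono τ)))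
                           (≤-trans (positive-lower-bound τ w∈ 0<fw′) (iter-≤-suc Product Σ e τ w))
  ...     | no 0≮fw′ = begin
    δ ^ suc (positives (suc τ))        ≤⟨ ^-antitone 0<δ δ≤1 (s≤s more-positives) ⟩
    δ * δ ^ suc (positives τ)          ≤⟨ *-mono-≤-nonNeg (<⇒≤ 0<c) (<⇒≤ (^-pos 0<δ δ≤1 (suc (positives τ)))) δ≤c (positive-lower-bound τ q∈ 0<fq) ⟩
    c * f τ q                          ≡⟨ sym fw≡cfq ⟩
    f (suc τ) w                        ∎
    where
    open ≤-Reasoning
    0<cfq : 0ℚ < c * f τ q
    0<cfq = subst (0ℚ <_) fw≡cfq 0<fw
    0<fq : 0ℚ < f τ q
    0<fq = ≤∧≢⇒< (proj₁ (f∈I τ q)) λ 0≡fq → 0<⇒≢0 0<cfq (trans (cong (c *_) (sym 0≡fq)) (*-zeroʳ c))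
    0<c : 0ℚ < c
    0<c = ≰⇒> λ c≤0 → <-irrefl refl (<-≤-trans 0<cfq
            (subst (c * f τ q ≤_) (*-zeroˡ (f τ q)) (*-monoʳ-≤-nonNeg (f τ q) {{nonNegative (<⇒≤ 0<fq)}} c≤0)))
    δ≤c : δ ≤ c
    δ≤c = minAbove≤ (bases ++ links Product Σ) (∈-++⁺ʳ bases c∈) 0<c
    more-positives : suc (positives τ) ≤ₙ positives (suc τ)
    more-positives = count-strict _ _ V (λ {v} _ 0<fv → <-≤-trans 0<fv (iter-≤-suc Product Σ e τ v)) w∈ 0≮fw′ 0<fw

  β : ℚ
  β = δ ^ suc M

  0<β : 0ℚ < β
  0<β = ^-pos 0<δ δ≤1 (suc M)

  β≤positive : ∀ τ {w} → w ∈ V → 0ℚ < f τ w → β ≤ f τ w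
  β≤positive τ w∈ 0<fw = ≤-trans (^-antitone 0<δ δ≤1 (s≤s (count≤length _ V))) (positive-lower-bound τ w∈ 0<fw)

  ρ : ℚ
  ρ = minAbove 1ℚ (1ℚ + 1ℚ) (composites M)

  0<ρ-1 : 0ℚ < ρ - 1ℚ
  0<ρ-1 = <⇒0<- (θ<minAbove (composites M) (subst (_< 1ℚ + 1ℚ) (+-identityʳ 1ℚ) (+-monoʳ-< 1ℚ 0<1)))

  gap : Gap ((ρ - 1ℚ) * β)
  gap τ {w} w∈ {π} π∈ y<πy = begin
    y + (ρ - 1ℚ) * β    ≤⟨ +-monoʳ-≤ y (*-monoˡ-≤-nonNeg (ρ - 1ℚ) {{nonNegative (<⇒≤ 0<ρ-1)}} (β≤positive τ w∈ 0<y)) ⟩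
    y + (ρ - 1ℚ) * y    ≡⟨ solve 2 (λ r y → y :+ (r :- con 1ℚ) :* y := r :* y) refl ρ y ⟩
    ρ * y               ≤⟨ *-monoʳ-≤-nonNeg y {{nonNegative 0≤y}} (minAbove≤ (composites M) π∈ 1<π) ⟩
    π * y               ∎
    where
    open ≤-Reasoning
    open +-*-Solver
    y = f τ w
    0≤y : 0ℚ ≤ y
    0≤y = proj₁ (f∈I τ w)
    0<y : 0ℚ < y
    0<y = ≤∧≢⇒< 0≤y λ 0≡y → <-irrefl refl (subst₂ _<_ (sym 0≡y) (trans (cong (π *_) (sym 0≡y)) (*-zeroʳ π)) y<πy)
    1<π : 1ℚ < π
    1<π = ≰⇒> λ π≤1 → <-irrefl refl (<-≤-trans y<πy
            (subst (π * y ≤_) (*-identityˡ y) (*-monoʳ-≤-nonNeg y {{nonNegative 0≤y}} π≤1)))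

  product-saturates : ∃ (OmegaEq Product Σ e)
  product-saturates = saturates (0<* 0<ρ-1 0<β) gap

lemma6 : (L : Algebra) (Σ : Theory) → All WellFormedFormula Σ →
         (e : Evaluation) → (∀ v → InUnit (e v)) →
         ∃ (λ (n : ℕ) → OmegaEq L Σ e n)
lemma6 Łukasiewicz = Łukasiewicz-saturates
lemma6 Product Σ wf e e∈I = ProductSaturation.product-saturates Σ wf e e∈I
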